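{- Let $p,q,r$ be three distinct primes and let $0<\varepsilon<1/4$ be fixed. Then for all sufficiently large powers $P=p^a$ there exist nonnegative integers $i$ and $j$ such that $\langle q^ir^j\rangle_P=1$ and \[ \min\bigl(\langle q^i\rangle_P,\ P-\langle q^i\rangle_P,\ \langle r^j\rangle_P,\ P-\langle r^j\rangle_P\bigr)>(\tfrac14-\varepsilon)P . \]
   Context: For a positive integer $P$ and an integer $n$, $\langle n\rangle_P$ denotes the least nonnegative residue of $n$ modulo $P$.
   Formalization: The fixed parameter ε ranges over the rationals strictly between 0 and 1/4. -}

module Defs where

open import Data.Nat using (ℕ; _%_; _∸_; _⊓_; NonZero)
open import Data.Rational using (ℚ; _-_; _*_; _<_; 1ℚ; 0ℚ; _/_)
import Data.Rational as ℚ
open import Data.Integer using (+_)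

res : (n P : ℕ) → .{{NonZero P}} → ℕ
res n P = n % P

minDist : (x y P : ℕ) → .{{NonZero P}} → ℕ
minDist x y P = (res x P ⊓ (P ∸ res x P)) ⊓ (res y P ⊓ (P ∸ res y P))

quarter : ℚ
quarter = + 1 / 4

natℚ : ℕ → ℚ
natℚ n = + n / 1

{-# OPTIONS --safe #-}
-- Let Q = p ^ (a - 1), so that P = p ^ a = p Q. Lifting the exponent gives, for all large a,
-- powers q ^ β = 1 + Q w and r ^ γ = 1 + Q v with w and v prime to p. Since P ∣ Q ^ 2,
-- (1 + Q w) ^ k ≡ 1 + k Q w (mod P), so raising these powers to T x and U y, where
-- x w ≡ y v ≡ 1 (mod p), T = ⌊p/2⌋ and U = ⌈p/2⌉, gives residues 1 + T Q and 1 + U Q.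
-- Their product is 1 + P + T U Q ^ 2 ≡ 1, and as both residues lie next to P/2, all four
-- distances are at least T Q - 1 ≥ P/4.
module Submission where

open import Defs
open import Data.Nat hiding (_<_)
import Data.Nat as N
open import Data.Nat.Properties
open import Data.Nat.DivMod hiding (_mod_)
open import Data.Nat.Divisibility
open import Data.Nat.Primality
open import Data.Nat.Coprimality using (Coprime; coprime-Bézout; 1-coprimeTo)
import Data.Nat.Coprimality as Coprimality
open import Data.Nat.GCD using (module Bézout)
open import Data.Nat.Tactic.RingSolver using (solve-∀)
open import Data.Nat.Induction using (<-wellFounded)
open import Induction.WellFounded using (Acc; acc)
open import Data.Fin using (Fin; toℕ; fromℕ<)
import Data.Fin.Properties as Fin
open import Data.Product
import Data.Integer as ℤ
import Data.Integer.Properties as ℤ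
open import Data.Rational using (ℚ; _-_; _<_; 0ℚ; mkℚ)
import Data.Rational as Q
import Data.Rational.Properties as Q
import Data.Rational.Unnormalised as Qᵘ
import Data.Rational.Unnormalised.Properties as Qᵘ
open import Data.Sum using (inj₁; inj₂)
open import Data.Empty using (⊥-elim)
open import Relation.Nullary using (¬_; yes; no)
open import Relation.Binary.Bundles using (Setoid)
open import Relation.Binary.Structures using (IsEquivalence)
open import Relation.Binary.PropositionalEquality
import Relation.Binary.Reasoning.Setoid as SetoidReasoning

-- Stated without subtraction, so that the ring solver applies to the witnessing equations.
infix 4 _≡_mod_

record _≡_mod_ (u v n : ℕ) : Set where
  constructor congruent
  field
    k l : ℕ
    k≡l : u + k * n ≡ v + l * n

module _ {n : ℕ} where

  mod-refl : ∀ {u} → u ≡ u mod n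
  mod-refl = congruent 0 0 refl

  mod-sym : ∀ {u v} → u ≡ v mod n → v ≡ u mod n
  mod-sym (congruent A B e) = congruent B A (sym e)

  mod-trans : ∀ {u v w} → u ≡ v mod n → v ≡ w mod n → u ≡ w mod n
  mod-trans {u} {v} {w} (congruent A B e) (congruent C D f) = congruent (A + C) (B + D) (begin
    u + (A + C) * n     ≡⟨ regroup u A C n ⟩
    (u + A * n) + C * n ≡⟨ cong (_+ C * n) e ⟩
    (v + B * n) + C * n ≡⟨ exchange v B C n ⟩
    (v + C * n) + B * n ≡⟨ cong (_+ B * n) f ⟩
    (w + D * n) + B * n ≡⟨ exchange w D B n ⟩
    (w + B * n) + D * n ≡⟨ regroup w B D n ⟨
    w + (B + D) * n     ∎)
    where
    open ≡-Reasoning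
    regroup : ∀ x a b n → x + (a + b) * n ≡ (x + a * n) + b * n
    regroup = solve-∀
    exchange : ∀ x a b n → (x + a * n) + b * n ≡ (x + b * n) + a * n
    exchange = solve-∀

  mod-isEquivalence : IsEquivalence (λ u v → u ≡ v mod n)
  mod-isEquivalence = record { refl = mod-refl ; sym = mod-sym ; trans = mod-trans }

mod-setoid : ℕ → Setoid _ _
mod-setoid n = record { isEquivalence = mod-isEquivalence {n} }

module ≡-mod-Reasoning (n : ℕ) = SetoidReasoning (mod-setoid n)

module _ {n : ℕ} where

  mod-+ : ∀ {u v x y} → u ≡ v mod n → x ≡ y mod n → u + x ≡ v + y mod n
  mod-+ {u} {v} {x} {y} (congruent A B e) (congruent C D f) = congruent (A + C) (B + D) (begin
    u + x + (A + C) * n       ≡⟨ regroup u x A C n ⟩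
    (u + A * n) + (x + C * n) ≡⟨ cong₂ _+_ e f ⟩
    (v + B * n) + (y + D * n) ≡⟨ regroup v y B D n ⟨
    v + y + (B + D) * n       ∎)
    where
    open ≡-Reasoning
    regroup : ∀ a b c d n → a + b + (c + d) * n ≡ (a + c * n) + (b + d * n)
    regroup = solve-∀

  mod-*ʳ : ∀ {u v} x → u ≡ v mod n → u * x ≡ v * x mod n
  mod-*ʳ {u} {v} x (congruent A B e) = congruent (A * x) (B * x) (begin
    u * x + A * x * n ≡⟨ distrib u A x n ⟩
    (u + A * n) * x   ≡⟨ cong (_* x) e ⟩
    (v + B * n) * x   ≡⟨ distrib v B x n ⟨
    v * x + B * x * n ∎)
    where
    open ≡-Reasoning
    distrib : ∀ a b x n → a * x + b * x * n ≡ (a + b * n) * x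
    distrib = solve-∀

  mod-* : ∀ {u v x y} → u ≡ v mod n → x ≡ y mod n → u * x ≡ v * y mod n
  mod-* {u} {v} {x} {y} u≡v x≡y = mod-trans (mod-*ʳ x u≡v)
    (subst₂ (λ a b → a ≡ b mod n) (*-comm x v) (*-comm y v) (mod-*ʳ v x≡y))

  ∣⇒≡0-mod : ∀ {u} → n ∣ u → u ≡ 0 mod n
  ∣⇒≡0-mod (divides k refl) = congruent 0 k (+-identityʳ _)

  mod⇒%≡ : ∀ {u v} .{{_ : NonZero n}} → u ≡ v mod n → u % n ≡ v % n
  mod⇒%≡ {u} {v} (congruent A B e) = begin
    u % n           ≡⟨ [m+kn]%n≡m%n u A n ⟨
    (u + A * n) % n ≡⟨ cong (_% n) e ⟩
    (v + B * n) % n ≡⟨ [m+kn]%n≡m%n v B n ⟩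
    v % n           ∎
    where open ≡-Reasoning

  %≡⇒mod : ∀ {u v} .{{_ : NonZero n}} → u % n ≡ v % n → u ≡ v mod n
  %≡⇒mod {u} {v} e = congruent (v / n) (u / n) (begin
    u + v / n * n                 ≡⟨ cong (_+ v / n * n) (m≡m%n+[m/n]*n u n) ⟩
    u % n + u / n * n + v / n * n ≡⟨ cong (λ r → r + u / n * n + v / n * n) e ⟩
    v % n + u / n * n + v / n * n ≡⟨ exchange (v % n) (u / n) (v / n) n ⟩
    v % n + v / n * n + u / n * n ≡⟨ cong (_+ u / n * n) (m≡m%n+[m/n]*n v n) ⟨
    v + u / n * n                 ∎)
    where
    open ≡-Reasoning
    exchange : ∀ r a b n → r + a * n + b * n ≡ r + b * n + a * n
    exchange = solve-∀

  mod-1⇒≡1+k*n : ∀ {g} .{{_ : NonZero n}} → 1 N.< n → g ≡ 1 mod n → g ≡ 1 + g / n * n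
  mod-1⇒≡1+k*n {g} 1<n g≡1 = begin
    g                 ≡⟨ m≡m%n+[m/n]*n g n ⟩
    g % n + g / n * n ≡⟨ cong (_+ g / n * n) (mod⇒%≡ g≡1) ⟩
    1 % n + g / n * n ≡⟨ cong (_+ g / n * n) (m<n⇒m%n≡m 1<n) ⟩
    1 + g / n * n     ∎
    where open ≡-Reasoning

  *-cancelˡ-mod-unit : ∀ {c u v} → (∃ λ x → x * c ≡ 1 mod n) → c * u ≡ c * v mod n → u ≡ v mod n
  *-cancelˡ-mod-unit {c} {u} {v} (x , xc≡1) cu≡cv = begin
    u           ≡⟨ *-identityˡ u ⟨
    1 * u       ≈⟨ mod-*ʳ u xc≡1 ⟨
    x * c * u   ≡⟨ *-assoc x c u ⟩
    x * (c * u) ≈⟨ mod-* (mod-refl {u = x}) cu≡cv ⟩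
    x * (c * v) ≡⟨ *-assoc x c v ⟨
    x * c * v   ≈⟨ mod-*ʳ v xc≡1 ⟩
    1 * v       ≡⟨ *-identityˡ v ⟩
    v           ∎
    where open ≡-mod-Reasoning n

mod-scale : ∀ {n u v} m → u ≡ v mod n → u * m ≡ v * m mod n * m
mod-scale {n} {u} {v} m (congruent A B e) = congruent A B (begin
  u * m + A * (n * m) ≡⟨ distrib u A m n ⟩
  (u + A * n) * m     ≡⟨ cong (_* m) e ⟩
  (v + B * n) * m     ≡⟨ distrib v B m n ⟨
  v * m + B * (n * m) ∎)
  where
  open ≡-Reasoning
  distrib : ∀ a b m n → a * m + b * (n * m) ≡ (a + b * n) * m
  distrib = solve-∀

≡1+mod⇒%≡1+ : ∀ {z X Y P} .{{_ : NonZero P}} → X + Y ≡ P → 2 ≤ Y → z ≡ 1 + X mod P → z % P ≡ 1 + X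
≡1+mod⇒%≡1+ {X = X} {Y} refl 2≤Y z≡1+X = trans (mod⇒%≡ z≡1+X) (m<n⇒m%n≡m (begin-strict
  1 + X ≡⟨ +-comm 1 X ⟩
  X + 1 <⟨ +-monoʳ-< X 2≤Y ⟩
  X + Y ∎))
  where open ≤-Reasoning

powers-collide : ∀ n .{{_ : NonZero n}} c → ∃₂ λ i d → 1 ≤ d × c ^ (i + d) ≡ c ^ i mod n
powers-collide n c = from-collision (Fin.pigeonhole (n<1+n n) residue)
  where
  residue : Fin (suc n) → Fin n
  residue k = fromℕ< (m%n<n (c ^ toℕ k) n)

  residue-≡ : ∀ k → toℕ (residue k) ≡ c ^ toℕ k % n
  residue-≡ k = Fin.toℕ-fromℕ< (m%n<n (c ^ toℕ k) n)

  from-collision : (∃₂ λ i j → toℕ i N.< toℕ j × residue i ≡ residue j) →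
                   ∃₂ λ i d → 1 ≤ d × c ^ (i + d) ≡ c ^ i mod n
  from-collision (i , j , i<j , same) with m≤n⇒∃[o]m+o≡n i<j
  ... | o , i+1+o≡j = toℕ i , suc o , s≤s z≤n , %≡⇒mod (begin
    c ^ (toℕ i + suc o) % n ≡⟨ cong (λ e → c ^ e % n) (trans (+-suc (toℕ i) o) i+1+o≡j) ⟩
    c ^ toℕ j % n           ≡⟨ residue-≡ j ⟨
    toℕ (residue j)         ≡⟨ cong toℕ same ⟨
    toℕ (residue i)         ≡⟨ residue-≡ i ⟩
    c ^ toℕ i % n           ∎)
    where open ≡-Reasoning

[1+y]^k≡1+k*y+y*y*s : ∀ y k → ∃ λ s → (1 + y) ^ k ≡ 1 + k * y + y * y * s
[1+y]^k≡1+k*y+y*y*s y zero    = 0 , base y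
  where
  base : ∀ y → 1 ≡ 1 + 0 * y + y * y * 0
  base = solve-∀
[1+y]^k≡1+k*y+y*y*s y (suc k) with [1+y]^k≡1+k*y+y*y*s y k
... | s , eq = k + s + y * s , trans (cong ((1 + y) *_) eq) (step y k s)
  where
  step : ∀ y k s → (1 + y) * (1 + k * y + y * y * s) ≡ 1 + suc k * y + y * y * (k + s + y * s)
  step = solve-∀

[1+y]^k≡1+k*y-mod : ∀ {n} y k → n ∣ y * y → (1 + y) ^ k ≡ 1 + k * y mod n
[1+y]^k≡1+k*y-mod {n} y k n∣y*y with [1+y]^k≡1+k*y+y*y*s y k
... | s , eq = begin
  (1 + y) ^ k           ≡⟨ eq ⟩
  1 + k * y + y * y * s ≈⟨ mod-+ (mod-refl {u = 1 + k * y}) (∣⇒≡0-mod (∣m⇒∣m*n s n∣y*y)) ⟩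
  1 + k * y + 0         ≡⟨ +-identityʳ (1 + k * y) ⟩
  1 + k * y             ∎
  where open ≡-mod-Reasoning n

[1+T*Q][1+U*Q]≡1 : ∀ {p Q T U} → p ∣ Q → T + U ≡ p → (1 + T * Q) * (1 + U * Q) ≡ 1 mod p * Q
[1+T*Q][1+U*Q]≡1 {p} {Q} {T} {U} p∣Q T+U≡p = begin
  (1 + T * Q) * (1 + U * Q)         ≡⟨ expand T U Q ⟩
  1 + (T + U) * Q + T * U * (Q * Q) ≡⟨ cong (λ t → 1 + t * Q + T * U * (Q * Q)) T+U≡p ⟩
  1 + p * Q + T * U * (Q * Q)       ≈⟨ mod-+ (mod-+ (mod-refl {u = 1}) (∣⇒≡0-mod ∣-refl))
                                             (∣⇒≡0-mod (∣n⇒∣m*n (T * U) (*-monoˡ-∣ Q p∣Q))) ⟩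
  1 + 0 + 0                         ≡⟨⟩
  1                                 ∎
  where
  open ≡-mod-Reasoning (p * Q)
  expand : ∀ T U Q → (1 + T * Q) * (1 + U * Q) ≡ 1 + (T + U) * Q + T * U * (Q * Q)
  expand = solve-∀

-- Q * Q vanishes modulo p * Q, and T x w ≡ T modulo p.
[1+Q*w]^k≡1+T*Q : ∀ {p Q w} → p ∣ Q → (∃ λ x → x * w ≡ 1 mod p) →
                  ∀ T → ∃ λ k → (1 + Q * w) ^ k ≡ 1 + T * Q mod p * Q
[1+Q*w]^k≡1+T*Q {p} {Q} {w} p∣Q (x , xw≡1) T = T * x , (begin
  (1 + Q * w) ^ (T * x) ≈⟨ [1+y]^k≡1+k*y-mod (Q * w) (T * x) pQ∣[Qw]² ⟩
  1 + T * x * (Q * w)   ≡⟨ cong (1 +_) (regroup T x Q w) ⟩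
  1 + T * (x * w) * Q   ≈⟨ mod-+ (mod-refl {u = 1}) (mod-scale Q (mod-* (mod-refl {u = T}) xw≡1)) ⟩
  1 + T * 1 * Q         ≡⟨ cong (λ t → 1 + t * Q) (*-identityʳ T) ⟩
  1 + T * Q             ∎)
  where
  open ≡-mod-Reasoning (p * Q)
  regroup : ∀ T x Q w → T * x * (Q * w) ≡ T * (x * w) * Q
  regroup = solve-∀
  square : ∀ Q w → Q * w * (Q * w) ≡ Q * Q * (w * w)
  square = solve-∀
  pQ∣[Qw]² : p * Q ∣ Q * w * (Q * w)
  pQ∣[Qw]² = subst (p * Q ∣_) (sym (square Q w)) (∣m⇒∣m*n (w * w) (*-monoˡ-∣ Q p∣Q))

2≤m⇒2≤m^n : ∀ {m} n → 2 ≤ m → 1 ≤ n → 2 ≤ m ^ n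
2≤m⇒2≤m^n {m@(suc _)} n 2≤m 1≤n = begin
  2     ≤⟨ 2≤m ⟩
  m     ≡⟨ *-identityʳ m ⟨
  m ^ 1 ≤⟨ ^-monoʳ-≤ m 1≤n ⟩
  m ^ n ∎
  where open ≤-Reasoning

⌈n/2⌉≤1+⌊n/2⌋ : ∀ n → ⌈ n /2⌉ ≤ suc ⌊ n /2⌋
⌈n/2⌉≤1+⌊n/2⌋ n = ⌊n/2⌋-mono (n≤1+n (suc n))

-- The slack 8 t + 2 t g + g is (2 T - 1) Q - 4 for T = 1 + t and Q = 4 + g.
[T+U]*Q≤4*[T*Q∸1] : ∀ {T U Q} → 1 ≤ T → U ≤ suc T → 4 ≤ Q → (T + U) * Q ≤ 4 * (T * Q ∸ 1)
[T+U]*Q≤4*[T*Q∸1] {suc t} {U} {Q} _ U≤1+T 4≤Q with m≤n⇒∃[o]m+o≡n 4≤Q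
... | g , refl = begin
  (suc t + U) * (4 + g)                                     ≤⟨ *-monoˡ-≤ (4 + g) (+-monoʳ-≤ (suc t) U≤1+T) ⟩
  (suc t + suc (suc t)) * (4 + g)                           ≤⟨ m≤m+n _ (8 * t + 2 * t * g + g) ⟩
  (suc t + suc (suc t)) * (4 + g) + (8 * t + 2 * t * g + g) ≡⟨ identity t g ⟩
  4 * (3 + (g + t * (4 + g)))                               ∎
  where
  open ≤-Reasoning
  identity : ∀ t g → (suc t + suc (suc t)) * (4 + g) + (8 * t + 2 * t * g + g) ≡ 4 * (3 + (g + t * (4 + g)))
  identity = solve-∀

minDist-terms-lower : ∀ X Y → (X ⊓ Y) ∸ 1 ≤ ((1 + X) ⊓ ((X + Y) ∸ (1 + X))) ⊓ ((1 + Y) ⊓ ((X + Y) ∸ (1 + Y)))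
minDist-terms-lower X Y =
  ⊓-glb (⊓-glb (below X (m⊓n≤m X Y)) (complement X Y (m⊓n≤n X Y)))
        (⊓-glb (below Y (m⊓n≤n X Y))
               (subst ((X ⊓ Y) ∸ 1 ≤_) (cong (_∸ (1 + Y)) (+-comm Y X)) (complement Y X (m⊓n≤m X Y))))
  where
  below : ∀ Z → X ⊓ Y ≤ Z → (X ⊓ Y) ∸ 1 ≤ 1 + Z
  below Z m≤Z = ≤-trans (m∸n≤m (X ⊓ Y) 1) (≤-trans m≤Z (n≤1+n Z))
  complement : ∀ Z W → X ⊓ Y ≤ W → (X ⊓ Y) ∸ 1 ≤ (Z + W) ∸ (1 + Z)
  complement Z W m≤W = subst ((X ⊓ Y) ∸ 1 ≤_)
    (trans (sym ([m+n]∸[m+o]≡n∸o Z W 1)) (cong ((Z + W) ∸_) (+-comm Z 1)))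
    (∸-monoˡ-≤ 1 m≤W)

minDist-lower : ∀ {x y X Y P} .{{_ : NonZero P}} → X + Y ≡ P →
                x % P ≡ 1 + X → y % P ≡ 1 + Y → (X ⊓ Y) ∸ 1 ≤ minDist x y P
minDist-lower {X = X} {Y} refl x%P≡1+X y%P≡1+Y rewrite x%P≡1+X | y%P≡1+Y = minDist-terms-lower X Y

Solution : (q r P : ℕ) → .{{NonZero P}} → Set
Solution q r P = ∃₂ λ i j → (q ^ i * r ^ j) % P ≡ 1 × P ≤ 4 * minDist (q ^ i) (r ^ j) P

module _ {p : ℕ} (pp : Prime p) where

  private instance
    p≢0 : NonZero p
    p≢0 = prime⇒nonZero pp

  1<p : 1 N.< p
  1<p = nonTrivial⇒n>1 p {{prime⇒nonTrivial pp}}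

  prime∤1 : ¬ p ∣ 1
  prime∤1 p∣1 = nonTrivial⇒≢1 {{prime⇒nonTrivial pp}} (∣1⇒≡1 p∣1)

  prime∤prime : ∀ {q} → Prime q → p ≢ q → ¬ p ∣ q
  prime∤prime qq p≢q p∣q with prime⇒irreducible qq p∣q
  ... | inj₁ p≡1 = prime∤1 (∣-reflexive p≡1)
  ... | inj₂ p≡q = p≢q p≡q

  ∤⇒∤^ : ∀ {c} → ¬ p ∣ c → ∀ i → ¬ p ∣ c ^ i
  ∤⇒∤^ p∤c zero    = prime∤1
  ∤⇒∤^ {c} p∤c (suc i) p∣c^[1+i] with euclidsLemma c (c ^ i) pp p∣c^[1+i]
  ... | inj₁ p∣c   = p∤c p∣c
  ... | inj₂ p∣c^i = ∤⇒∤^ p∤c i p∣c^i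

  ∤⇒coprime : ∀ {c} → ¬ p ∣ c → Coprime c p
  ∤⇒coprime p∤c (d∣c , d∣p) with prime⇒irreducible pp d∣p
  ... | inj₁ d≡1  = d≡1
  ... | inj₂ refl = ⊥-elim (p∤c d∣c)

  mod-inverse : ∀ {c} → ¬ p ∣ c → ∃ λ x → x * c ≡ 1 mod p
  mod-inverse {c} p∤c with coprime-Bézout (∤⇒coprime p∤c)
  ... | Bézout.+- x y eq = x , congruent 0 y (trans (+-identityʳ (x * c)) (sym eq))
  ... | Bézout.-+ x y eq = pred p * x , congruent 1 (pred p * y) (begin
    pred p * x * c + 1 * p            ≡⟨ cong (λ m → pred p * x * c + 1 * m) (suc-pred p) ⟨
    pred p * x * c + 1 * suc (pred p) ≡⟨ expand (pred p) x c ⟩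
    1 + pred p * (1 + x * c)          ≡⟨ cong (λ m → 1 + pred p * m) eq ⟩
    1 + pred p * (y * p)              ≡⟨ cong (1 +_) (*-assoc (pred p) y p) ⟨
    1 + pred p * y * p                ∎)
    where
    open ≡-Reasoning
    expand : ∀ N x c → N * x * c + 1 * suc N ≡ 1 + N * (1 + x * c)
    expand = solve-∀

  power≡1-mod : ∀ {c} → ¬ p ∣ c → ∃ λ d → 1 ≤ d × c ^ d ≡ 1 mod p
  power≡1-mod {c} p∤c with powers-collide p c
  ... | i , d , 1≤d , c^[i+d]≡c^i = d , 1≤d ,
    *-cancelˡ-mod-unit (mod-inverse (∤⇒∤^ p∤c i))
      (subst₂ (λ a b → a ≡ b mod p) (^-distribˡ-+-* c i d) (sym (*-identityʳ (c ^ i))) c^[i+d]≡c^i)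

  valuation-decomposition : ∀ m → .{{NonZero m}} → ∃₂ λ e w → m ≡ p ^ e * w × ¬ p ∣ w
  valuation-decomposition m = go m (<-wellFounded m)
    where
    go : ∀ m → Acc N._<_ m → .{{NonZero m}} → ∃₂ λ e w → m ≡ p ^ e * w × ¬ p ∣ w
    go m (acc smaller) with p ∣? m
    ... | no p∤m = 0 , m , sym (*-identityˡ m) , p∤m
    ... | yes (divides k refl) = times-p (go k (smaller (m<m*n k p 1<p)))
      where
      instance
        k≢0 : NonZero k
        k≢0 = m*n≢0⇒m≢0 k
      times-p : (∃₂ λ e w → k ≡ p ^ e * w × ¬ p ∣ w) → ∃₂ λ e w → k * p ≡ p ^ e * w × ¬ p ∣ w
      times-p (e , w , k≡p^e*w , p∤w) = suc e , w , trans (cong (_* p) k≡p^e*w) (rotate p (p ^ e) w) , p∤w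
        where
        rotate : ∀ p a w → a * w * p ≡ p * a * w
        rotate = solve-∀

  -- From exponent 2 on, the quadratic term of the binomial expansion is divisible by p ^ (4 + e),
  -- so the new cofactor stays ≡ w modulo p; this is what makes the case p = 2 work.
  lift-step : ∀ e {w} → ¬ p ∣ w → ∃ λ v → (1 + p ^ (2 + e) * w) ^ p ≡ 1 + p ^ (3 + e) * v × ¬ p ∣ v
  lift-step e {w} p∤w with [1+y]^k≡1+k*y+y*y*s (p ^ (2 + e) * w) p
  ... | s , eq = w + p * (p ^ e * w * w * s) , trans eq (factor p (p ^ e) w s) , p∤v
    where
    factor : ∀ p a w s → 1 + p * (p * (p * a) * w) + p * (p * a) * w * (p * (p * a) * w) * s
                         ≡ 1 + p * (p * (p * a)) * (w + p * (a * w * w * s))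
    factor = solve-∀
    p∤v : ¬ p ∣ w + p * (p ^ e * w * w * s)
    p∤v p∣v = p∤w (∣m+n∣m⇒∣n (subst (p ∣_) (+-comm w _) p∣v) (m∣m*n _))

  lift : ∀ e {w} → ¬ p ∣ w → ∀ s →
         ∃ λ v → (1 + p ^ (2 + e) * w) ^ (p ^ s) ≡ 1 + p ^ (2 + e + s) * v × ¬ p ∣ v
  lift e {w} p∤w zero = w , trans (*-identityʳ _) (cong (λ t → 1 + p ^ t * w) (sym (+-identityʳ (2 + e)))) , p∤w
  lift e {w} p∤w (suc s) with lift-step e p∤w
  ... | w₁ , eq₁ , p∤w₁ with lift (suc e) p∤w₁ s
  ... | v , eq , p∤v = v , (begin
    x ^ (p * p ^ s)                  ≡⟨ ^-*-assoc x p (p ^ s) ⟨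
    (x ^ p) ^ (p ^ s)                ≡⟨ cong (_^ (p ^ s)) eq₁ ⟩
    (1 + p ^ (3 + e) * w₁) ^ (p ^ s) ≡⟨ eq ⟩
    1 + p ^ (3 + e + s) * v          ≡⟨ cong (λ t → 1 + p ^ t * v) (+-suc (2 + e) s) ⟨
    1 + p ^ (2 + e + suc s) * v      ∎) , p∤v
    where
    open ≡-Reasoning
    x : ℕ
    x = 1 + p ^ (2 + e) * w

  ExactLevel : ℕ → ℕ → Set
  ExactLevel c Q = ∃₂ λ β w → c ^ β ≡ 1 + Q * w × ¬ p ∣ w

  first-level : ∀ {g} → g ≡ 1 mod p → 2 ≤ g → ∃ λ e → ExactLevel g (p ^ (2 + e))
  first-level {g} g≡1 2≤g with g / p | mod-1⇒≡1+k*n 1<p g≡1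
  ... | zero  | refl = ⊥-elim (<⇒≱ 2≤g ≤-refl)
  ... | suc k | refl with [1+y]^k≡1+k*y+y*y*s (suc k * p) p
  ... | s , eq with valuation-decomposition (suc k + suc k * suc k * s)
  ... | e , w , split , p∤w = e , p , w , (begin
    (1 + suc k * p) ^ p                               ≡⟨ eq ⟩
    1 + p * (suc k * p) + suc k * p * (suc k * p) * s ≡⟨ factor p (suc k) s ⟩
    1 + p * p * (suc k + suc k * suc k * s)           ≡⟨ cong (λ t → 1 + p * p * t) split ⟩
    1 + p * p * (p ^ e * w)                           ≡⟨ cong (1 +_) (reassoc p (p ^ e) w) ⟩
    1 + p ^ (2 + e) * w                               ∎) , p∤w
    where
    open ≡-Reasoning
    factor : ∀ p m s → 1 + p * (m * p) + m * p * (m * p) * s ≡ 1 + p * p * (m + m * m * s)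
    factor = solve-∀
    reassoc : ∀ p a w → p * p * (a * w) ≡ p * (p * a) * w
    reassoc = solve-∀

  exact-level-root : ∀ {c d Q} → ExactLevel (c ^ d) Q → ExactLevel c Q
  exact-level-root {c} {d} (β , w , c^dβ≡ , p∤w) = d * β , w , trans (sym (^-*-assoc c d β)) c^dβ≡ , p∤w

  exact-level-raise : ∀ {c e} → ExactLevel c (p ^ (2 + e)) → ∀ b → 2 + e ≤ b → ExactLevel c (p ^ b)
  exact-level-raise {c} {e} (β , w , c^β≡ , p∤w) b 2+e≤b with m≤n⇒∃[o]m+o≡n 2+e≤b
  ... | s , refl with lift e p∤w s
  ... | v , eq , p∤v = β * p ^ s , v , (begin
    c ^ (β * p ^ s)               ≡⟨ ^-*-assoc c β (p ^ s) ⟨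
    (c ^ β) ^ p ^ s               ≡⟨ cong (_^ p ^ s) c^β≡ ⟩
    (1 + p ^ (2 + e) * w) ^ p ^ s ≡⟨ eq ⟩
    1 + p ^ (2 + e + s) * v       ∎) , p∤v
    where open ≡-Reasoning

  levels : ∀ {c} → 2 ≤ c → ¬ p ∣ c → ∃ λ b₀ → ∀ b → b₀ ≤ b → ExactLevel c (p ^ b)
  levels {c} 2≤c p∤c = from-order (power≡1-mod p∤c)
    where
    from-order : (∃ λ d → 1 ≤ d × c ^ d ≡ 1 mod p) → ∃ λ b₀ → ∀ b → b₀ ≤ b → ExactLevel c (p ^ b)
    from-order (d , 1≤d , c^d≡1) =
      map (2 +_) (λ {e} level → exact-level-raise (exact-level-root {d = d} {Q = p ^ (2 + e)} level))
          (first-level c^d≡1 (2≤m⇒2≤m^n d 2≤c 1≤d))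

  power≡1+T*Q-mod : ∀ {Q g} → p ∣ Q → ExactLevel g Q → ∀ T → ∃ λ i → g ^ i ≡ 1 + T * Q mod p * Q
  power≡1+T*Q-mod {Q} {g} p∣Q (β , w , g^β≡ , p∤w) T =
    map (β *_) raise ([1+Q*w]^k≡1+T*Q p∣Q (mod-inverse p∤w) T)
    where
    raise : ∀ {k} → (1 + Q * w) ^ k ≡ 1 + T * Q mod p * Q → g ^ (β * k) ≡ 1 + T * Q mod p * Q
    raise {k} = subst (λ h → h ≡ 1 + T * Q mod p * Q) (trans (cong (_^ k) (sym g^β≡)) (^-*-assoc g β k))

  halves-minDist : ∀ {Q x y} .{{_ : NonZero (p * Q)}} → 4 ≤ Q →
                   x ≡ 1 + ⌊ p /2⌋ * Q mod p * Q → y ≡ 1 + ⌈ p /2⌉ * Q mod p * Q →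
                   p * Q ≤ 4 * minDist x y (p * Q)
  halves-minDist {Q} {x} {y} 4≤Q x≡ y≡ = begin
    p * Q                     ≡⟨ cong (_* Q) (⌊n/2⌋+⌈n/2⌉≡n p) ⟨
    (T + U) * Q               ≤⟨ [T+U]*Q≤4*[T*Q∸1] 1≤T (⌈n/2⌉≤1+⌊n/2⌋ p) 4≤Q ⟩
    4 * (T * Q ∸ 1)           ≡⟨ cong (λ m → 4 * (m ∸ 1)) (m≤n⇒m⊓n≡m (*-monoˡ-≤ Q (⌊n/2⌋≤⌈n/2⌉ p))) ⟨
    4 * ((T * Q) ⊓ (U * Q) ∸ 1) ≤⟨ *-monoʳ-≤ 4 (minDist-lower X+Y≡P x-residue y-residue) ⟩
    4 * minDist x y (p * Q)   ∎
    where
    open ≤-Reasoning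
    T U : ℕ
    T = ⌊ p /2⌋
    U = ⌈ p /2⌉
    1≤T : 1 ≤ T
    1≤T = ⌊n/2⌋-mono 1<p
    1≤U : 1 ≤ U
    1≤U = ≤-trans 1≤T (⌊n/2⌋≤⌈n/2⌉ p)
    2≤*Q : ∀ {S} → 1 ≤ S → 2 ≤ S * Q
    2≤*Q 1≤S = ≤-trans (s≤s (s≤s z≤n)) (*-mono-≤ 1≤S 4≤Q)
    X+Y≡P : T * Q + U * Q ≡ p * Q
    X+Y≡P = trans (sym (*-distribʳ-+ Q T U)) (cong (_* Q) (⌊n/2⌋+⌈n/2⌉≡n p))
    x-residue : x % (p * Q) ≡ 1 + T * Q
    x-residue = ≡1+mod⇒%≡1+ X+Y≡P (2≤*Q 1≤U) x≡
    y-residue : y % (p * Q) ≡ 1 + U * Q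
    y-residue = ≡1+mod⇒%≡1+ (trans (+-comm (U * Q) (T * Q)) X+Y≡P) (2≤*Q 1≤T) y≡

  halves-product : ∀ {Q x y} .{{_ : NonZero (p * Q)}} → p ∣ Q → 4 ≤ Q →
                   x ≡ 1 + ⌊ p /2⌋ * Q mod p * Q → y ≡ 1 + ⌈ p /2⌉ * Q mod p * Q → (x * y) % (p * Q) ≡ 1
  halves-product {Q} p∣Q 4≤Q x≡ y≡ = trans
    (mod⇒%≡ (mod-trans (mod-* x≡ y≡) ([1+T*Q][1+U*Q]≡1 {T = ⌊ p /2⌋} p∣Q (⌊n/2⌋+⌈n/2⌉≡n p))))
    (m<n⇒m%n≡m (≤-trans (s≤s (s≤s z≤n)) (≤-trans 4≤Q (m≤n*m Q p))))

  level-solution : ∀ {Q q r} .{{_ : NonZero (p * Q)}} → p ∣ Q → 4 ≤ Q →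
                   ExactLevel q Q → ExactLevel r Q → Solution q r (p * Q)
  level-solution {Q} {q} {r} p∣Q 4≤Q q-level r-level =
    combine (power≡1+T*Q-mod p∣Q q-level ⌊ p /2⌋) (power≡1+T*Q-mod p∣Q r-level ⌈ p /2⌉)
    where
    combine : (∃ λ i → q ^ i ≡ 1 + ⌊ p /2⌋ * Q mod p * Q) → (∃ λ j → r ^ j ≡ 1 + ⌈ p /2⌉ * Q mod p * Q) →
              Solution q r (p * Q)
    combine (i , q^i≡) (j , r^j≡) = i , j , halves-product p∣Q 4≤Q q^i≡ r^j≡ , halves-minDist 4≤Q q^i≡ r^j≡

  solution-at : ∀ {q r} a → 2 ≤ a → ExactLevel q (p ^ a) → ExactLevel r (p ^ a) →
                Solution q r (p ^ suc a) {{m^n≢0 p (suc a)}}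
  solution-at (suc a) (s≤s 1≤a) = level-solution {{m^n≢0 p (2 + a)}} (m∣m*n (p ^ a)) 4≤p^[1+a]
    where
    4≤p^[1+a] : 4 ≤ p ^ suc a
    4≤p^[1+a] = ≤-trans (^-monoʳ-≤ 2 (s≤s 1≤a)) (^-monoˡ-≤ (suc a) 1<p)

  solution-eventually : ∀ {q r} → 2 ≤ q → ¬ p ∣ q → 2 ≤ r → ¬ p ∣ r →
                        ∃ λ A → ∀ a → A ≤ a → Solution q r (p ^ a) {{m^n≢0 p a}}
  solution-eventually {q} {r} 2≤q p∤q 2≤r p∤r = combine (levels 2≤q p∤q) (levels 2≤r p∤r)
    where
    combine : (∃ λ b₁ → ∀ b → b₁ ≤ b → ExactLevel q (p ^ b)) →
              (∃ λ b₂ → ∀ b → b₂ ≤ b → ExactLevel r (p ^ b)) →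
              ∃ λ A → ∀ a → A ≤ a → Solution q r (p ^ a) {{m^n≢0 p a}}
    combine (b₁ , q-levels) (b₂ , r-levels) = suc (2 ⊔ b₁ ⊔ b₂) , λ where
      (suc a) (s≤s bound≤a) →
        solution-at a (m⊔n≤o⇒m≤o 2 b₁ (m⊔n≤o⇒m≤o (2 ⊔ b₁) b₂ bound≤a))
          (q-levels a (m⊔n≤o⇒n≤o 2 b₁ (m⊔n≤o⇒m≤o (2 ⊔ b₁) b₂ bound≤a)))
          (r-levels a (m⊔n≤o⇒n≤o (2 ⊔ b₁) b₂ bound≤a))

natℚ≡mkℚ : ∀ n → natℚ n ≡ mkℚ (ℤ.+ n) 0 (Coprimality.sym (1-coprimeTo n))
natℚ≡mkℚ n = Q.normalize-coprime (Coprimality.sym (1-coprimeTo n))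

quarter≡mkℚ : quarter ≡ mkℚ (ℤ.+ 1) 3 (1-coprimeTo 4)
quarter≡mkℚ = Q.normalize-coprime (1-coprimeTo 4)

quarter*n≤m-ᵘ : ∀ n m → n ≤ 4 * m → Qᵘ.mkℚᵘ (ℤ.+ 1) 3 Qᵘ.* Qᵘ.mkℚᵘ (ℤ.+ n) 0 Qᵘ.≤ Qᵘ.mkℚᵘ (ℤ.+ m) 0
quarter*n≤m-ᵘ n m n≤4m = Qᵘ.*≤* (subst₂ ℤ._≤_ lhs rhs (ℤ.+≤+ n≤m*4))
  where
  n≤m*4 : 1 * n * 1 ≤ m * 4
  n≤m*4 = subst₂ _≤_ (sym (trans (*-identityʳ (1 * n)) (*-identityˡ n))) (*-comm 4 m) n≤4m
  lhs : ℤ.+ (1 * n * 1) ≡ (ℤ.+ 1 ℤ.* ℤ.+ n) ℤ.* ℤ.+ 1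
  lhs = trans (ℤ.pos-* (1 * n) 1) (cong (ℤ._* ℤ.+ 1) (ℤ.pos-* 1 n))
  rhs : ℤ.+ (m * 4) ≡ ℤ.+ m ℤ.* ℤ.+ 4
  rhs = ℤ.pos-* m 4

quarter*n≤m : ∀ {n m} → n ≤ 4 * m → quarter Q.* natℚ n Q.≤ natℚ m
quarter*n≤m {n} {m} n≤4m =
  Q.toℚᵘ-cancel-≤ (Qᵘ.≤-respˡ-≃ (Qᵘ.≃-sym (Q.toℚᵘ-homo-* quarter (natℚ n))) unnormalised)
  where
  unnormalised : Q.toℚᵘ quarter Qᵘ.* Q.toℚᵘ (natℚ n) Qᵘ.≤ Q.toℚᵘ (natℚ m)
  unnormalised rewrite quarter≡mkℚ | natℚ≡mkℚ n | natℚ≡mkℚ m = quarter*n≤m-ᵘ n m n≤4m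

[quarter-ε]*n<m : ∀ {ε n m} → 0ℚ < ε → 1 ≤ n → n ≤ 4 * m → (quarter - ε) Q.* natℚ n < natℚ m
[quarter-ε]*n<m {ε} {suc n} {m} 0<ε _ n≤4m = Q.<-≤-trans shrink (quarter*n≤m {m = m} n≤4m)
  where
  instance
    natℚ-pos : Q.Positive (natℚ (suc n))
    natℚ-pos = Q.normalize-pos (suc n) 1
  shrink : (quarter - ε) Q.* natℚ (suc n) < quarter Q.* natℚ (suc n)
  shrink = Q.*-monoˡ-<-pos (natℚ (suc n))
    (Q.<-respʳ-≡ (Q.+-identityʳ quarter) (Q.+-monoʳ-< quarter (Q.neg-antimono-< 0<ε)))

Solution⇒quarter-bound : ∀ {q r P ε} .{{_ : NonZero P}} → 0ℚ < ε → Solution q r P →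
  ∃₂ λ i j → res (q ^ i * r ^ j) P ≡ 1 × (quarter - ε) Q.* natℚ P < natℚ (minDist (q ^ i) (r ^ j) P)
Solution⇒quarter-bound {q} {r} {P} 0<ε (i , j , product≡1 , bound) =
  i , j , product≡1 , [quarter-ε]*n<m {m = minDist (q ^ i) (r ^ j) P} 0<ε (>-nonZero⁻¹ P) bound

lemma4 : (p q r : ℕ) → (pp : Prime p) → Prime q → Prime r → p ≢ q → p ≢ r → q ≢ r →
    (ε : ℚ) → 0ℚ < ε → ε < quarter →
    ∃ λ (A : ℕ) → ∀ (a : ℕ) → A ≤ a →
      let instance
            _ = m^n≢0 p a {{prime⇒nonZero pp}}
      in
      ∃ λ (i : ℕ) → ∃ λ (j : ℕ) →
        (res (q ^ i N.* r ^ j) (p ^ a) ≡ 1) ×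
        ((quarter - ε) Q.* natℚ (p ^ a) < natℚ (minDist (q ^ i) (r ^ j) (p ^ a)))
lemma4 p q r pp qq rr p≢q p≢r _ ε 0<ε _ =
  map₂ (λ solution a A≤a → Solution⇒quarter-bound {{m^n≢0 p a {{prime⇒nonZero pp}}}} 0<ε (solution a A≤a))
       (solution-eventually pp (1<p qq) (prime∤prime pp qq p≢q) (1<p rr) (prime∤prime pp rr p≢r))
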